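{- For $k\ge 0$ let $f_k(x_1,\dots,x_k)=\sum_{\gamma} x_1^{p_1}x_2^{p_2}\cdots x_k^{p_k}$, the sum (a formal power series) running over all standard paths $\gamma$ (of any length) whose final composition $(p_1,\dots,p_k)$ has exactly $k$ parts. Then $f_0=1$, $f_1(x_1)=\dfrac{x_1}{1-x_1}$, and for every $k>1$ \[ f_k(x_1,\dots,x_k)=\frac{x_1 f_{k-1}(x_2,\dots,x_k)+x_k f_{k-1}(x_1,\dots,x_{k-1})-x_1x_2\cdots x_k}{1-x_1-x_2-\cdots-x_k}. \] In particular each $f_k$ is a rational function.
   Context: A composition is a finite sequence $P=(p_1,\dots,p_k)$ of positive integers (its parts); $k$ is the number of parts (the width of $P$), the empty composition $()$ has $0$ parts, and the weight of $P$ is $p_1+\cdots+p_k$. Define a covering relation: $Q$ covers $P=(p_1,\dots,p_k)$ if $Q$ is one of $(1,p_1,\dots,p_k)$, $(p_1,\dots,p_k,1)$, or $(p_1,\dots,p_i+1,\dots,p_k)$ for some $1\le i\le k$. Its transitive closure is a partial order $\mathfrak{N}$ on the set of all compositions. A standard path of length $n$ is a sequence $(P_0,P_1,\dots,P_n)$ of compositions with $P_i$ of weight $i$ and $P_{i+1}$ covering $P_i$ for each $i$ (so $P_0=()$); its final composition is $P_n$. Two standard paths are equal iff they are equal as sequences of compositions. -}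

module Defs where

open import Data.Nat as ℕ using (ℕ; zero; suc)
open import Data.Integer as ℤ using (ℤ; +_)
open import Data.Fin as Fin using (Fin)
open import Data.List as List using (List; []; _∷_; [_]; _++_)
open import Data.List.Relation.Unary.All using (All)
open import Data.Nat.ListAction using (sum)
open import Data.Vec as Vec using (Vec)
open import Data.Vec.Properties using (≡-dec)
open import Data.Maybe using (Maybe; just)
open import Data.Bool using (if_then_else_)
open import Data.Product using (Σ; _×_; ∃)
open import Data.Sum using (_⊎_)
open import Relation.Nullary.Decidable using (⌊_⌋)
open import Relation.Binary.PropositionalEquality using (_≡_)
open import Function.Definitions using (Injective)

Composition : Set
Composition = List ℕ

IsComposition : Composition → Set
IsComposition P = All (λ p → 1 ℕ.≤ p) P

weight : Composition → ℕ
weight = sum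

data Inc : Composition → Composition → Set where
  here  : ∀ {p ps} → Inc (suc p ∷ ps) (p ∷ ps)
  there : ∀ {p ps qs} → Inc qs ps → Inc (p ∷ qs) (p ∷ ps)

Covers : Composition → Composition → Set
Covers Q P = (Q ≡ 1 ∷ P) ⊎ (Q ≡ P ++ [ 1 ]) ⊎ Inc Q P

data Chain : ℕ → List Composition → Set where
  single : ∀ {i P} → IsComposition P → weight P ≡ i → Chain i (P ∷ [])
  cons   : ∀ {i P Q γ} → IsComposition P → weight P ≡ i → Covers Q P →
           Chain (suc i) (Q ∷ γ) → Chain i (P ∷ Q ∷ γ)

-- A standard path (P_0, …, P_n), as the sequence of its compositions
-- (P_0 is forced to be () since it is a composition of weight 0).
IsStandardPath : List Composition → Set
IsStandardPath γ = Chain 0 γ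

final : List Composition → Maybe Composition
final = List.last

CountsPathsTo : ℕ → Composition → Set
CountsPathsTo c P =
  Σ (Fin c → List Composition) λ enum →
    Injective _≡_ _≡_ enum ×
    (∀ i → IsStandardPath (enum i) × final (enum i) ≡ just P) ×
    (∀ γ → IsStandardPath γ → final γ ≡ just P → ∃ λ i → enum i ≡ γ)

-- Formal power series in k variables x_1,…,x_k over ℤ:
-- a series is its coefficient function on exponent vectors.

FPS : ℕ → Set
FPS k = Vec ℕ k → ℤ

_≈_ : ∀ {k} → FPS k → FPS k → Set
f ≈ g = ∀ e → f e ≡ g e
infix 4 _≈_

below : ∀ {k} → Vec ℕ k → List (Vec ℕ k)
below Vec.[] = [ Vec.[] ]
below (n Vec.∷ e) =
  List.concatMap (λ a → List.map (a Vec.∷_) (below e)) (List.upTo (suc n))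

monomial : ∀ {k} → Vec ℕ k → FPS k
monomial m e = if ⌊ ≡-dec ℕ._≟_ e m ⌋ then + 1 else + 0

oneS : ∀ {k} → FPS k
oneS {k} = monomial (Vec.replicate k 0)

-- the variable x_{i+1}
var : ∀ {k} → Fin k → FPS k
var i = monomial (Vec.tabulate (λ j → if ⌊ i Fin.≟ j ⌋ then 1 else 0))

_+S_ : ∀ {k} → FPS k → FPS k → FPS k
(f +S g) e = f e ℤ.+ g e

_-S_ : ∀ {k} → FPS k → FPS k → FPS k
(f -S g) e = f e ℤ.- g e

_*S_ : ∀ {k} → FPS k → FPS k → FPS k
(f *S g) e =
  List.foldr ℤ._+_ (+ 0)
    (List.map (λ a → f a ℤ.* g (Vec.zipWith ℕ._∸_ e a)) (below e))

infixl 6 _+S_ _-S_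
infixl 7 _*S_

sumVars : ∀ {k} → FPS k
sumVars {k} = List.foldr _+S_ (λ _ → + 0) (List.map var (List.allFin k))

prodVars : ∀ {k} → FPS k
prodVars {k} = monomial (Vec.replicate k 1)

-- g(x_2,…,x_{k+1}) viewed as a series in x_1,…,x_{k+1}
substTail : ∀ {k} → FPS k → FPS (suc k)
substTail g e = if ⌊ Vec.head e ℕ.≟ 0 ⌋ then g (Vec.tail e) else + 0

-- g(x_1,…,x_k) viewed as a series in x_1,…,x_{k+1}
substInit : ∀ {k} → FPS k → FPS (suc k)
substInit g e = if ⌊ Vec.last e ℕ.≟ 0 ⌋ then g (Vec.init e) else + 0

-- f_k given the path counts c: coefficient of x_1^{p_1}⋯x_k^{p_k}
-- is the number of standard paths with final composition (p_1,…,p_k).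
genSeries : ((k : ℕ) → Vec ℕ k → ℕ) → (k : ℕ) → FPS k
genSeries c k e = + c k e

{-# OPTIONS --safe #-}
-- A standard path ending at a nonempty composition P is a standard path ending at a composition Q
-- covered by P, extended by P. The compositions covered by P = (p₁, …, pₖ) are (p₂, …, pₖ) if p₁ = 1,
-- (p₁, …, pₖ₋₁) if pₖ = 1 (the same one exactly when P = (1, …, 1)), and P − eᵢ for each i with pᵢ ≥ 1.
-- Grouping paths by their penultimate composition gives, for the number c(P) of paths ending at P,
--   c(P) = [p₁ = 1] c(p₂, …, pₖ) + [pₖ = 1] c(p₁, …, pₖ₋₁) − [P = (1, …, 1)] + Σᵢ [pᵢ ≥ 1] c(P − eᵢ),
-- where c(1, …, 1) = 1. Multiplying fₖ by 1 − x₁ − ⋯ − xₖ removes the last sum from every coefficient,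
-- and the remaining terms are the coefficients of x₁ fₖ₋₁(x₂, …, xₖ), xₖ fₖ₋₁(x₁, …, xₖ₋₁) and x₁⋯xₖ.
module Submission where

open import Defs
open import Data.Nat using (ℕ; suc)
open import Data.Fin using (zero; fromℕ)
open import Data.Vec using (Vec; toList)
open import Data.Product using (_×_; _,_)

module Enumerations where

  open import Data.Nat using (ℕ; zero; suc; _+_; _≤_)
  open import Data.Nat.Properties using (≤-antisym)
  open import Data.Nat.ListAction using (sum)
  open import Data.Fin as Fin using (Fin; splitAt; join)
  open import Data.Fin.Properties using (injective⇒≤; splitAt-join; join-splitAt; suc-injective; 0≢1+n)
  open import Data.List as List using ()
  open import Data.Product using (∃; _×_; _,_; proj₁; proj₂)
  open import Data.Sum using (_⊎_; inj₁; inj₂; [_,_]′)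
  open import Data.Bool using (if_then_else_)
  open import Data.Empty using (⊥-elim)
  open import Level using (0ℓ)
  open import Relation.Nullary using (Dec; does; yes; no)
  open import Relation.Unary using (Pred; _⊆_; _≐_; _∪_; _⊥_; ⋃; ∅)
  open import Relation.Binary.PropositionalEquality using (_≡_; refl; sym; trans; cong; subst)
  open import Function using (_∘_)
  open import Function.Definitions using (Injective)

  private variable
    A B : Set
    m n : ℕ
    S T : Pred A 0ℓ

  record Enumeration {A : Set} (S : Pred A 0ℓ) (n : ℕ) : Set where
    field
      enum      : Fin n → A
      injective : Injective _≡_ _≡_ enum
      sound     : ∀ i → S (enum i)
      complete  : ∀ {x} → S x → ∃ λ i → enum i ≡ x

  open Enumeration

  size-mono : Enumeration S m → Enumeration T n → S ⊆ T → m ≤ n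
  size-mono E F S⊆T = injective⇒≤ {f = proj₁ ∘ position} position-injective
    where
    position : ∀ i → ∃ λ j → enum F j ≡ enum E i
    position i = complete F (S⊆T (sound E i))
    position-injective : Injective _≡_ _≡_ (proj₁ ∘ position)
    position-injective {i} {j} eq =
      injective E (trans (sym (proj₂ (position i))) (trans (cong (enum F) eq) (proj₂ (position j))))

  size-unique : Enumeration S m → Enumeration T n → S ≐ T → m ≡ n
  size-unique E F (S⊆T , T⊆S) = ≤-antisym (size-mono E F S⊆T) (size-mono F E T⊆S)

  enumeration-∅ : Enumeration {A} ∅ 0
  enumeration-∅ = record { enum = λ () ; injective = λ {} ; sound = λ () ; complete = λ () }

  enumeration-≐ : S ≐ T → Enumeration S n → Enumeration T n
  enumeration-≐ (S⊆T , T⊆S) E = record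
    { enum = enum E ; injective = injective E ; sound = S⊆T ∘ sound E ; complete = complete E ∘ T⊆S }

  enumeration-image : (f : A → B) → Injective _≡_ _≡_ f → Enumeration S n →
                      Enumeration (λ y → ∃ λ x → S x × f x ≡ y) n
  enumeration-image f f-injective E = record
    { enum      = f ∘ enum E
    ; injective = injective E ∘ f-injective
    ; sound     = λ i → enum E i , sound E i , refl
    ; complete  = λ { (x , s , refl) → let i , eᵢ≡x = complete E s in i , cong f eᵢ≡x }
    }

  enumeration-∪ : S ⊥ T → Enumeration S m → Enumeration T n → Enumeration (S ∪ T) (m + n)
  enumeration-∪ {A} {S = S} {T = T} {m = m} {n = n} S⊥T E F = record
    { enum      = [ enum E , enum F ]′ ∘ splitAt m
    ; injective = λ {i} {j} eq →
        trans (sym (join-splitAt m n i))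
          (trans (cong (join m n) (both-injective (splitAt m i) (splitAt m j) eq)) (join-splitAt m n j))
    ; sound     = both-sound ∘ splitAt m
    ; complete  = λ { (inj₁ s) → located (inj₁ (complete E s))
                    ; (inj₂ t) → located (inj₂ (complete F t)) }
    }
    where
    both : Fin m ⊎ Fin n → A
    both = [ enum E , enum F ]′

    both-sound : ∀ k → (S ∪ T) (both k)
    both-sound (inj₁ i) = inj₁ (sound E i)
    both-sound (inj₂ j) = inj₂ (sound F j)

    both-injective : ∀ k l → both k ≡ both l → k ≡ l
    both-injective (inj₁ i) (inj₁ j) eq = cong inj₁ (injective E eq)
    both-injective (inj₁ i) (inj₂ j) eq = ⊥-elim (S⊥T (sound E i , subst T (sym eq) (sound F j)))
    both-injective (inj₂ i) (inj₁ j) eq = ⊥-elim (S⊥T (sound E j , subst T eq (sound F i)))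
    both-injective (inj₂ i) (inj₂ j) eq = cong inj₂ (injective F eq)

    located : ∀ {x} → (∃ λ i → enum E i ≡ x) ⊎ (∃ λ j → enum F j ≡ x) → ∃ λ k → both (splitAt m k) ≡ x
    located (inj₁ (i , eq)) = join m n (inj₁ i) , trans (cong both (splitAt-join m n (inj₁ i))) eq
    located (inj₂ (j , eq)) = join m n (inj₂ j) , trans (cong both (splitAt-join m n (inj₂ j))) eq

  enumeration-⋃ : ∀ {k} {X : Fin k → Pred A 0ℓ} {size : Fin k → ℕ} →
                  (∀ {i j x} → X i x → X j x → i ≡ j) → (∀ i → Enumeration (X i) (size i)) →
                  Enumeration (⋃ (Fin k) X) (sum (List.tabulate size))
  enumeration-⋃ {k = zero} _ _ = enumeration-≐ ((λ ()) , λ ()) enumeration-∅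
  enumeration-⋃ {k = suc k} {X} pairwise E =
    enumeration-≐ (split , merge)
      (enumeration-∪ (λ (x₀ , (i , xᵢ)) → 0≢1+n (pairwise x₀ xᵢ))
         (E Fin.zero) (enumeration-⋃ (λ xᵢ xⱼ → suc-injective (pairwise xᵢ xⱼ)) (E ∘ Fin.suc)))
    where
    split : X Fin.zero ∪ ⋃ (Fin k) (X ∘ Fin.suc) ⊆ ⋃ (Fin (suc k)) X
    split (inj₁ x₀) = Fin.zero , x₀
    split (inj₂ (i , xᵢ)) = Fin.suc i , xᵢ
    merge : ⋃ (Fin (suc k)) X ⊆ X Fin.zero ∪ ⋃ (Fin k) (X ∘ Fin.suc)
    merge (Fin.zero , x₀) = inj₁ x₀
    merge (Fin.suc i , xᵢ) = inj₂ (i , xᵢ)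

  enumeration-guard : {P : Set} (P? : Dec P) → Enumeration S n →
                      Enumeration (λ x → P × S x) (if does P? then n else 0)
  enumeration-guard (yes p) E = enumeration-≐ ((p ,_) , proj₂) E
  enumeration-guard (no ¬p) E = enumeration-≐ ((λ ()) , λ (p , _) → ¬p p) enumeration-∅

module SeriesCoefficients where

  open import Data.Nat as ℕ using (ℕ; zero; suc; _∸_; _≤?_; _≡ᵇ_; _≤ᵇ_)
  import Data.Nat.Properties as ℕ
  open import Data.Nat.ListAction using (sum)
  open import Data.Integer using (ℤ; +_; _+_; _-_; _*_; -_)
  import Data.Integer.Properties as ℤ
  open import Data.Integer.Solver using (module +-*-Solver)
  open import Data.Fin as Fin using (Fin)
  open import Data.Vec using (Vec; []; _∷_; zipWith)
  open import Data.Vec.Properties using (≡-dec)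
  open import Data.Vec.Relation.Binary.Pointwise.Inductive as Pointwise using (Pointwise)
  open import Data.List as List using (List; []; _∷_; _++_; map; foldr; applyUpTo; upTo; concatMap)
  open import Data.List.Properties using (map-++; map-cong; map-∘; map-upTo; map-tabulate)
  open import Data.Bool using (Bool; true; false; _∧_; if_then_else_)
  open import Relation.Nullary using (Dec; does)
  open import Relation.Nullary.Decidable using (isYes≗does)
  open import Relation.Binary.PropositionalEquality using (_≡_; refl; sym; trans; cong; cong₂; module ≡-Reasoning)
  open import Function using (_∘_; id)

  private variable
    A : Set
    k : ℕ

  _≤ᵛ_ : Vec ℕ k → Vec ℕ k → Set
  _≤ᵛ_ = Pointwise ℕ._≤_

  _≤ᵛ?_ : (m e : Vec ℕ k) → Dec (m ≤ᵛ e)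
  _≤ᵛ?_ = Pointwise.decidable _≤?_

  _∸ᵛ_ : Vec ℕ k → Vec ℕ k → Vec ℕ k
  _∸ᵛ_ = zipWith _∸_

  _≟ᵛ_ : (u v : Vec ℕ k) → Dec (u ≡ v)
  _≟ᵛ_ = ≡-dec ℕ._≟_

  infixr 8 [_]·_
  [_]·_ : Bool → ℤ → ℤ
  [ b ]· x = if b then x else + 0

  sumℤ : List ℤ → ℤ
  sumℤ = foldr _+_ (+ 0)

  sumℤ-++ : ∀ xs ys → sumℤ (xs ++ ys) ≡ sumℤ xs + sumℤ ys
  sumℤ-++ [] ys = sym (ℤ.+-identityˡ _)
  sumℤ-++ (x ∷ xs) ys = trans (cong (_+_ x) (sumℤ-++ xs ys)) (sym (ℤ.+-assoc x _ _))

  sumℤ-concatMap : ∀ {B : Set} (φ : B → ℤ) (g : A → List B) xs →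
                   sumℤ (map φ (concatMap g xs)) ≡ sumℤ (map (λ x → sumℤ (map φ (g x))) xs)
  sumℤ-concatMap φ g [] = refl
  sumℤ-concatMap φ g (x ∷ xs) = trans (cong sumℤ (map-++ φ (g x) (concatMap g xs)))
    (trans (sumℤ-++ (map φ (g x)) _) (cong (_+_ (sumℤ (map φ (g x)))) (sumℤ-concatMap φ g xs)))

  sumℤ-zeros : ∀ (xs : List A) → sumℤ (map (λ _ → + 0) xs) ≡ + 0
  sumℤ-zeros [] = refl
  sumℤ-zeros (_ ∷ xs) = trans (ℤ.+-identityˡ _) (sumℤ-zeros xs)

  sumℤ-map-+ : ∀ (f g : A → ℤ) xs → sumℤ (map (λ x → f x + g x) xs) ≡ sumℤ (map f xs) + sumℤ (map g xs)
  sumℤ-map-+ f g [] = refl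
  sumℤ-map-+ f g (x ∷ xs) = trans (cong (_+_ (f x + g x)) (sumℤ-map-+ f g xs)) (swap (f x) (g x) _ _)
    where
    open +-*-Solver
    swap : ∀ a b c d → a + b + (c + d) ≡ a + c + (b + d)
    swap = solve 4 (λ a b c d → a :+ b :+ (c :+ d) := a :+ c :+ (b :+ d)) refl

  sumℤ-map-neg : ∀ (f : A → ℤ) xs → sumℤ (map (λ x → - f x) xs) ≡ - sumℤ (map f xs)
  sumℤ-map-neg f [] = refl
  sumℤ-map-neg f (x ∷ xs) = trans (cong (_+_ (- f x)) (sumℤ-map-neg f xs)) (sym (ℤ.neg-distrib-+ (f x) _))

  sumℤ-tabulate-+ : ∀ {k} (g : Fin k → ℤ) (f : Fin k → ℕ) → (∀ i → g i ≡ + f i) →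
                    sumℤ (List.tabulate g) ≡ + sum (List.tabulate f)
  sumℤ-tabulate-+ {zero} g f eq = refl
  sumℤ-tabulate-+ {suc k} g f eq =
    trans (cong₂ _+_ (eq Fin.zero) (sumℤ-tabulate-+ (g ∘ Fin.suc) (f ∘ Fin.suc) (eq ∘ Fin.suc)))
          (sym (ℤ.pos-+ (f Fin.zero) _))

  +-if : ∀ b x → + (if b then x else 0) ≡ [ b ]· + x
  +-if true x = refl
  +-if false x = refl

  sumUpTo : ℕ → (ℕ → ℤ) → ℤ
  sumUpTo n f = sumℤ (applyUpTo f n)

  sumBelow : Vec ℕ k → (Vec ℕ k → ℤ) → ℤ
  sumBelow e φ = sumℤ (map φ (below e))

  sumUpTo-cong : ∀ n {f g : ℕ → ℤ} → (∀ a → f a ≡ g a) → sumUpTo n f ≡ sumUpTo n g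
  sumUpTo-cong zero eq = refl
  sumUpTo-cong (suc n) eq = cong₂ _+_ (eq 0) (sumUpTo-cong n (eq ∘ suc))

  sumBelow-cong : ∀ (e : Vec ℕ k) {φ ψ} → (∀ v → φ v ≡ ψ v) → sumBelow e φ ≡ sumBelow e ψ
  sumBelow-cong e eq = cong sumℤ (map-cong eq (below e))

  sumBelow-∷ : ∀ n (e : Vec ℕ k) (φ : Vec ℕ (suc k) → ℤ) →
               sumBelow (n ∷ e) φ ≡ sumUpTo (suc n) (λ a → sumBelow e (φ ∘ (a ∷_)))
  sumBelow-∷ n e φ = trans (sumℤ-concatMap φ (λ a → map (a ∷_) (below e)) (upTo (suc n)))
    (trans (cong sumℤ (map-cong (λ a → cong sumℤ (sym (map-∘ (below e)))) (upTo (suc n))))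
           (cong sumℤ (map-upTo (λ a → sumBelow e (φ ∘ (a ∷_))) (suc n))))

  sumBelow-guard : ∀ (e : Vec ℕ k) b (φ : Vec ℕ k → ℤ) → sumBelow e (λ v → [ b ]· φ v) ≡ [ b ]· sumBelow e φ
  sumBelow-guard e true φ = refl
  sumBelow-guard e false φ = sumℤ-zeros (below e)

  guard-∧ : ∀ a b x → [ a ∧ b ]· x ≡ [ a ]· [ b ]· x
  guard-∧ true b x = refl
  guard-∧ false b x = refl

  sumUpTo-guard-∧ : ∀ n (e : Vec ℕ k) (p : ℕ → Bool) (q : Vec ℕ k → Bool) (φ : Vec ℕ (suc k) → ℤ) →
                    sumUpTo (suc n) (λ a → sumBelow e (λ v → [ p a ∧ q v ]· φ (a ∷ v)))
                    ≡ sumUpTo (suc n) (λ a → [ p a ]· sumBelow e (λ v → [ q v ]· φ (a ∷ v)))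
  sumUpTo-guard-∧ n e p q φ = sumUpTo-cong (suc n) λ a →
    trans (sumBelow-cong e (λ v → guard-∧ (p a) (q v) (φ (a ∷ v)))) (sumBelow-guard e (p a) _)

  ≤ᵇ-suc : ∀ m n → (suc m ≤ᵇ suc n) ≡ (m ≤ᵇ n)
  ≤ᵇ-suc zero n = refl
  ≤ᵇ-suc (suc m) n = refl

  sumUpTo-δ : ∀ n m (g : ℕ → ℤ) → sumUpTo (suc n) (λ a → [ a ≡ᵇ m ]· g a) ≡ [ m ≤ᵇ n ]· g m
  sumUpTo-δ zero zero g = ℤ.+-identityʳ (g 0)
  sumUpTo-δ zero (suc m) g = refl
  sumUpTo-δ (suc n) zero g = trans (cong (_+_ (g 0)) (sumUpTo-δ n zero (λ _ → + 0))) (ℤ.+-identityʳ (g 0))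
  sumUpTo-δ (suc n) (suc m) g = trans (ℤ.+-identityˡ _)
    (trans (sumUpTo-δ n m (g ∘ suc)) (cong (λ b → [ b ]· g (suc m)) (sym (≤ᵇ-suc m n))))

  sumUpTo-δ-∸ : ∀ n m (g : ℕ → ℤ) → sumUpTo (suc n) (λ a → [ (n ∸ a) ≡ᵇ m ]· g a) ≡ [ m ≤ᵇ n ]· g (n ∸ m)
  sumUpTo-δ-∸ zero zero g = ℤ.+-identityʳ (g 0)
  sumUpTo-δ-∸ zero (suc m) g = refl
  sumUpTo-δ-∸ (suc n) m g =
    trans (cong (_+_ ([ suc n ≡ᵇ m ]· g 0)) (sumUpTo-δ-∸ n m (g ∘ suc))) (first+rest n m)
    where
    first+rest : ∀ n m → [ suc n ≡ᵇ m ]· g 0 + [ m ≤ᵇ n ]· g (suc (n ∸ m)) ≡ [ m ≤ᵇ suc n ]· g (suc n ∸ m)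
    first+rest n zero = ℤ.+-identityˡ _
    first+rest zero (suc zero) = ℤ.+-identityʳ (g 0)
    first+rest zero (suc (suc m)) = refl
    first+rest (suc n) (suc m) rewrite ≤ᵇ-suc m n | ≤ᵇ-suc m (suc n) = first+rest n m

  sumBelow-δ : ∀ (e m : Vec ℕ k) (φ : Vec ℕ k → ℤ) →
               sumBelow e (λ a → [ does (a ≟ᵛ m) ]· φ a) ≡ [ does (m ≤ᵛ? e) ]· φ m
  sumBelow-δ [] [] φ = ℤ.+-identityʳ (φ [])
  sumBelow-δ (n ∷ e) (m₀ ∷ m) φ = begin
    sumBelow (n ∷ e) (λ a → [ does (a ≟ᵛ (m₀ ∷ m)) ]· φ a)
      ≡⟨ sumBelow-∷ n e _ ⟩
    sumUpTo (suc n) (λ a → sumBelow e (λ v → [ (a ≡ᵇ m₀) ∧ does (v ≟ᵛ m) ]· φ (a ∷ v)))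
      ≡⟨ sumUpTo-guard-∧ n e (_≡ᵇ m₀) (λ v → does (v ≟ᵛ m)) φ ⟩
    sumUpTo (suc n) (λ a → [ a ≡ᵇ m₀ ]· sumBelow e (λ v → [ does (v ≟ᵛ m) ]· φ (a ∷ v)))
      ≡⟨ sumUpTo-cong (suc n) (λ a → cong [ a ≡ᵇ m₀ ]·_ (sumBelow-δ e m (φ ∘ (a ∷_)))) ⟩
    sumUpTo (suc n) (λ a → [ a ≡ᵇ m₀ ]· [ does (m ≤ᵛ? e) ]· φ (a ∷ m))
      ≡⟨ sumUpTo-δ n m₀ (λ a → [ does (m ≤ᵛ? e) ]· φ (a ∷ m)) ⟩
    [ m₀ ≤ᵇ n ]· [ does (m ≤ᵛ? e) ]· φ (m₀ ∷ m)
      ≡⟨ guard-∧ (m₀ ≤ᵇ n) _ _ ⟨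
    [ does ((m₀ ∷ m) ≤ᵛ? (n ∷ e)) ]· φ (m₀ ∷ m) ∎
    where open ≡-Reasoning

  sumBelow-δ-∸ : ∀ (e m : Vec ℕ k) (φ : Vec ℕ k → ℤ) →
                 sumBelow e (λ a → [ does ((e ∸ᵛ a) ≟ᵛ m) ]· φ a) ≡ [ does (m ≤ᵛ? e) ]· φ (e ∸ᵛ m)
  sumBelow-δ-∸ [] [] φ = ℤ.+-identityʳ (φ [])
  sumBelow-δ-∸ (n ∷ e) (m₀ ∷ m) φ = begin
    sumBelow (n ∷ e) (λ a → [ does (((n ∷ e) ∸ᵛ a) ≟ᵛ (m₀ ∷ m)) ]· φ a)
      ≡⟨ sumBelow-∷ n e _ ⟩
    sumUpTo (suc n) (λ a → sumBelow e (λ v → [ ((n ∸ a) ≡ᵇ m₀) ∧ does ((e ∸ᵛ v) ≟ᵛ m) ]· φ (a ∷ v)))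
      ≡⟨ sumUpTo-guard-∧ n e (λ a → (n ∸ a) ≡ᵇ m₀) (λ v → does ((e ∸ᵛ v) ≟ᵛ m)) φ ⟩
    sumUpTo (suc n) (λ a → [ (n ∸ a) ≡ᵇ m₀ ]· sumBelow e (λ v → [ does ((e ∸ᵛ v) ≟ᵛ m) ]· φ (a ∷ v)))
      ≡⟨ sumUpTo-cong (suc n) (λ a → cong [ (n ∸ a) ≡ᵇ m₀ ]·_ (sumBelow-δ-∸ e m (φ ∘ (a ∷_)))) ⟩
    sumUpTo (suc n) (λ a → [ (n ∸ a) ≡ᵇ m₀ ]· [ does (m ≤ᵛ? e) ]· φ (a ∷ (e ∸ᵛ m)))
      ≡⟨ sumUpTo-δ-∸ n m₀ (λ a → [ does (m ≤ᵛ? e) ]· φ (a ∷ (e ∸ᵛ m))) ⟩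
    [ m₀ ≤ᵇ n ]· [ does (m ≤ᵛ? e) ]· φ ((n ∸ m₀) ∷ (e ∸ᵛ m))
      ≡⟨ guard-∧ (m₀ ≤ᵇ n) _ _ ⟨
    [ does ((m₀ ∷ m) ≤ᵛ? (n ∷ e)) ]· φ ((n ∷ e) ∸ᵛ (m₀ ∷ m)) ∎
    where open ≡-Reasoning

  *-guardʳ : ∀ x b → x * ([ b ]· + 1) ≡ [ b ]· x
  *-guardʳ x true = ℤ.*-identityʳ x
  *-guardʳ x false = ℤ.*-zeroʳ x

  *-guardˡ : ∀ b x → ([ b ]· + 1) * x ≡ [ b ]· x
  *-guardˡ true x = ℤ.*-identityˡ x
  *-guardˡ false x = refl

  coeff-*S-monomial : ∀ (F : FPS k) m e → (F *S monomial m) e ≡ [ does (m ≤ᵛ? e) ]· F (e ∸ᵛ m)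
  coeff-*S-monomial F m e = trans (sumBelow-cong e λ a →
      trans (cong (λ b → F a * ([ b ]· + 1)) (isYes≗does ((e ∸ᵛ a) ≟ᵛ m))) (*-guardʳ (F a) _))
    (sumBelow-δ-∸ e m F)

  coeff-monomial-*S : ∀ (F : FPS k) m e → (monomial m *S F) e ≡ [ does (m ≤ᵛ? e) ]· F (e ∸ᵛ m)
  coeff-monomial-*S F m e = trans (sumBelow-cong e λ a →
      trans (cong (λ b → ([ b ]· + 1) * F (e ∸ᵛ a)) (isYes≗does (a ≟ᵛ m))) (*-guardˡ _ (F (e ∸ᵛ a))))
    (sumBelow-δ e m (λ a → F (e ∸ᵛ a)))

  *S-distribˡ-+S : ∀ (F G H : FPS k) → F *S (G +S H) ≈ F *S G +S F *S H
  *S-distribˡ-+S F G H e = trans (sumBelow-cong e (λ a → ℤ.*-distribˡ-+ (F a) (G (e ∸ᵛ a)) (H (e ∸ᵛ a))))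
    (sumℤ-map-+ (λ a → F a * G (e ∸ᵛ a)) (λ a → F a * H (e ∸ᵛ a)) (below e))

  *S-distribˡ--S : ∀ (F G H : FPS k) → F *S (G -S H) ≈ F *S G -S F *S H
  *S-distribˡ--S F G H e = trans (sumBelow-cong e (λ a → distrib (F a) (G (e ∸ᵛ a)) (H (e ∸ᵛ a))))
    (trans (sumℤ-map-+ (λ a → F a * G (e ∸ᵛ a)) (λ a → - (F a * H (e ∸ᵛ a))) (below e))
           (cong (_+_ ((F *S G) e)) (sumℤ-map-neg (λ a → F a * H (e ∸ᵛ a)) (below e))))
    where
    distrib : ∀ f x y → f * (x - y) ≡ f * x + - (f * y)
    distrib f x y = trans (ℤ.*-distribˡ-+ f x (- y)) (cong (_+_ (f * x)) (sym (ℤ.neg-distribʳ-* f y)))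

  *S-zeroʳ : ∀ (F : FPS k) → F *S (λ _ → + 0) ≈ (λ _ → + 0)
  *S-zeroʳ F e = trans (sumBelow-cong e (λ a → ℤ.*-zeroʳ (F a))) (sumℤ-zeros (below e))

  *S-foldr-+S : ∀ (F : FPS k) (Gs : List (FPS k)) e →
                (F *S foldr _+S_ (λ _ → + 0) Gs) e ≡ sumℤ (map (λ G → (F *S G) e) Gs)
  *S-foldr-+S F [] e = *S-zeroʳ F e
  *S-foldr-+S F (G ∷ Gs) e =
    trans (*S-distribˡ-+S F G (foldr _+S_ (λ _ → + 0) Gs) e) (cong (_+_ ((F *S G) e)) (*S-foldr-+S F Gs e))

  coeff-*S-sumVars : ∀ (F : FPS k) e → (F *S sumVars) e ≡ sumℤ (List.tabulate (λ i → (F *S var i) e))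
  coeff-*S-sumVars {k} F e = trans (*S-foldr-+S F (map var (List.allFin k)) e)
    (trans (cong sumℤ (sym (map-∘ (List.allFin k)))) (cong sumℤ (map-tabulate id (λ i → (F *S var i) e))))

module ExponentVectors where

  open SeriesCoefficients using (_≤ᵛ_; _∸ᵛ_)
  open import Data.Nat using (ℕ; zero; suc; _∸_; _≤_; z≤n; s≤s)
  open import Data.Nat.Properties using (1+n≢n)
  open import Data.Fin as Fin using (Fin)
  open import Data.Vec as Vec using (Vec; []; _∷_; toList; tabulate; replicate; head; tail; init; last)
  open import Data.Vec.Properties
    using (tabulate-cong; ∷-injectiveˡ; ∷-injectiveʳ; toList-injective; toList-∷ʳ; length-toList)
  open import Data.Vec.Relation.Binary.Equality.Cast using (cast-is-id)
  open import Data.Vec.Relation.Binary.Pointwise.Inductive using ([]; _∷_)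
  import Data.List as List
  import Data.List.Properties as List
  open import Data.List.Relation.Unary.All using (_∷_)
  open import Data.Sum using (_⊎_; inj₁; inj₂)
  open import Data.Bool using (if_then_else_)
  open import Data.Product using (∃; _×_; _,_; proj₂)
  open import Data.Empty using (⊥-elim)
  open import Relation.Nullary using (¬_)
  open import Relation.Nullary.Decidable using (⌊_⌋; ⌊⌋-map′)
  open import Relation.Binary.PropositionalEquality using (_≡_; _≢_; refl; sym; trans; cong; cong₂; subst)
  open import Function using (_∘_)

  private variable
    k : ℕ

  -- The exponent vector of var i, so that var i is definitionally monomial (unitVec i).
  unitVec : Fin k → Vec ℕ k
  unitVec i = tabulate (λ j → if ⌊ i Fin.≟ j ⌋ then 1 else 0)

  unitVec-zero : unitVec {suc k} Fin.zero ≡ 1 ∷ replicate k 0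
  unitVec-zero = cong (1 ∷_) (zeros _)
    where
    zeros : ∀ k → tabulate {n = k} (λ _ → 0) ≡ replicate k 0
    zeros zero = refl
    zeros (suc k) = cong (0 ∷_) (zeros k)

  unitVec-suc : ∀ (i : Fin k) → unitVec (Fin.suc i) ≡ 0 ∷ unitVec i
  unitVec-suc i = cong (0 ∷_) (tabulate-cong λ j → cong (λ b → if b then 1 else 0) (⌊⌋-map′ _ _ (i Fin.≟ j)))

  replicate-0-≤ᵛ : ∀ (e : Vec ℕ k) → replicate k 0 ≤ᵛ e
  replicate-0-≤ᵛ [] = []
  replicate-0-≤ᵛ (x ∷ e) = z≤n ∷ replicate-0-≤ᵛ e

  ∸ᵛ-replicate-0 : ∀ (e : Vec ℕ k) → e ∸ᵛ replicate k 0 ≡ e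
  ∸ᵛ-replicate-0 [] = refl
  ∸ᵛ-replicate-0 (x ∷ e) = cong (x ∷_) (∸ᵛ-replicate-0 e)

  ∸ᵛ-unitVec-zero : ∀ x (e : Vec ℕ k) → (x ∷ e) ∸ᵛ unitVec Fin.zero ≡ (x ∸ 1) ∷ e
  ∸ᵛ-unitVec-zero x e = trans (cong ((x ∷ e) ∸ᵛ_) unitVec-zero) (cong ((x ∸ 1) ∷_) (∸ᵛ-replicate-0 e))

  ∸ᵛ-unitVec-suc : ∀ x (e : Vec ℕ k) i → (x ∷ e) ∸ᵛ unitVec (Fin.suc i) ≡ x ∷ (e ∸ᵛ unitVec i)
  ∸ᵛ-unitVec-suc x e i = cong ((x ∷ e) ∸ᵛ_) (unitVec-suc i)

  unitVec-zero-≤ᵛ : ∀ {x} (e : Vec ℕ k) → 1 ≤ x → unitVec Fin.zero ≤ᵛ (x ∷ e)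
  unitVec-zero-≤ᵛ {x = x} e 1≤x = subst (_≤ᵛ (x ∷ e)) (sym unitVec-zero) (1≤x ∷ replicate-0-≤ᵛ e)

  unitVec-suc-≤ᵛ : ∀ {x} {e : Vec ℕ k} i → unitVec i ≤ᵛ e → unitVec (Fin.suc i) ≤ᵛ (x ∷ e)
  unitVec-suc-≤ᵛ {x = x} {e} i le = subst (_≤ᵛ (x ∷ e)) (sym (unitVec-suc i)) (z≤n ∷ le)

  unitVec-suc-≤ᵛ⁻ : ∀ {x} {e : Vec ℕ k} i → unitVec (Fin.suc i) ≤ᵛ (x ∷ e) → unitVec i ≤ᵛ e
  unitVec-suc-≤ᵛ⁻ {x = x} {e} i le with _ ∷ le′ ← subst (_≤ᵛ (x ∷ e)) (unitVec-suc i) le = le′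

  ∸1-≢ : ∀ {x} → 1 ≤ x → x ∸ 1 ≢ x
  ∸1-≢ {suc p} _ = 1+n≢n ∘ sym

  inc-toList⁻ : ∀ (e : Vec ℕ k) {Q} → Inc (toList e) Q → ∃ λ i → unitVec i ≤ᵛ e × Q ≡ toList (e ∸ᵛ unitVec i)
  inc-toList⁻ (suc p ∷ e) here =
    Fin.zero , unitVec-zero-≤ᵛ e (s≤s z≤n) , sym (cong toList (∸ᵛ-unitVec-zero (suc p) e))
  inc-toList⁻ (x ∷ e) (there inc) with inc-toList⁻ e inc
  ... | i , le , refl = Fin.suc i , unitVec-suc-≤ᵛ i le , sym (cong toList (∸ᵛ-unitVec-suc x e i))

  inc-toList⁺ : ∀ (e : Vec ℕ k) i → unitVec i ≤ᵛ e → Inc (toList e) (toList (e ∸ᵛ unitVec i))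
  inc-toList⁺ (suc p ∷ e) Fin.zero _ = subst (Inc _) (sym (cong toList (∸ᵛ-unitVec-zero (suc p) e))) here
  inc-toList⁺ (zero ∷ e) Fin.zero (() ∷ _)
  inc-toList⁺ (x ∷ e) (Fin.suc i) le = subst (Inc _) (sym (cong toList (∸ᵛ-unitVec-suc x e i)))
    (there (inc-toList⁺ e i (unitVec-suc-≤ᵛ⁻ i le)))

  ∸ᵛ-unitVec-≢ : ∀ (e : Vec ℕ k) i → unitVec i ≤ᵛ e → e ∸ᵛ unitVec i ≢ e
  ∸ᵛ-unitVec-≢ (x ∷ e) Fin.zero (1≤x ∷ _) eq = ∸1-≢ 1≤x (∷-injectiveˡ eq)
  ∸ᵛ-unitVec-≢ (x ∷ e) (Fin.suc i) le eq =
    ∸ᵛ-unitVec-≢ e i (unitVec-suc-≤ᵛ⁻ i le) (∷-injectiveʳ (trans (sym (∸ᵛ-unitVec-suc x e i)) eq))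

  ∸ᵛ-unitVec-injective : ∀ (e : Vec ℕ k) {i j} → unitVec i ≤ᵛ e → e ∸ᵛ unitVec i ≡ e ∸ᵛ unitVec j → i ≡ j
  ∸ᵛ-unitVec-injective e {Fin.zero} {Fin.zero} _ _ = refl
  ∸ᵛ-unitVec-injective (x ∷ e) {Fin.zero} {Fin.suc j} (1≤x ∷ _) eq =
    ⊥-elim (∸1-≢ 1≤x (∷-injectiveˡ (trans eq (∸ᵛ-unitVec-suc x e j))))
  ∸ᵛ-unitVec-injective (x ∷ e) {Fin.suc i} {Fin.zero} le eq =
    ⊥-elim (∸ᵛ-unitVec-≢ e i (unitVec-suc-≤ᵛ⁻ i le)
      (∷-injectiveʳ (trans (sym (∸ᵛ-unitVec-suc x e i)) (trans eq (∸ᵛ-unitVec-zero x e)))))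
  ∸ᵛ-unitVec-injective (x ∷ e) {Fin.suc i} {Fin.suc j} le eq =
    cong Fin.suc (∸ᵛ-unitVec-injective e (unitVec-suc-≤ᵛ⁻ i le)
      (∷-injectiveʳ (trans (sym (∸ᵛ-unitVec-suc x e i)) (trans eq (∸ᵛ-unitVec-suc x e j)))))

  replicate-1-∸ᵛ-unitVec : ∀ (i : Fin k) → ¬ IsComposition (toList (replicate k 1 ∸ᵛ unitVec i))
  replicate-1-∸ᵛ-unitVec Fin.zero comp
    with () ∷ _ ← subst (IsComposition ∘ toList) (∸ᵛ-unitVec-zero 1 _) comp
  replicate-1-∸ᵛ-unitVec (Fin.suc i) comp
    with _ ∷ comp′ ← subst (IsComposition ∘ toList) (∸ᵛ-unitVec-suc 1 _ i) comp = replicate-1-∸ᵛ-unitVec i comp′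

  toList-cancel : ∀ {A : Set} {n} (u v : Vec A n) → toList u ≡ toList v → u ≡ v
  toList-cancel u v eq = trans (sym (cast-is-id refl u)) (toList-injective refl u v eq)

  toList-≢-suc : ∀ {A : Set} {n} (u : Vec A n) (v : Vec A (suc n)) → toList u ≢ toList v
  toList-≢-suc u v eq = 1+n≢n (sym (trans (sym (length-toList u)) (trans (cong List.length eq) (length-toList v))))

  toList-init-last : ∀ {A : Set} {n} (e : Vec A (suc n)) → toList e ≡ toList (init e) List.∷ʳ last e
  toList-init-last e = trans (cong toList (proj₂ (proj₂ (Vec.initLast e)))) (toList-∷ʳ (last e) (init e))

  init≡tail⇒≡replicate : ∀ {A : Set} {n} (e : Vec A (suc n)) → init e ≡ tail e → e ≡ replicate (suc n) (last e)
  init≡tail⇒≡replicate {n = zero} (x ∷ []) _ = refl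
  init≡tail⇒≡replicate {n = suc n} (x ∷ y ∷ e) eq with refl ← ∷-injectiveˡ eq =
    cong₂ _∷_ (cong head rest) rest
    where
    rest : x ∷ e ≡ replicate (suc n) (last (x ∷ e))
    rest = init≡tail⇒≡replicate (x ∷ e) (∷-injectiveʳ eq)

  init-replicate : ∀ {A : Set} n (x : A) → init (replicate (suc n) x) ≡ replicate n x
  init-replicate zero x = refl
  init-replicate (suc n) x = cong (x ∷_) (init-replicate n x)

  last-replicate : ∀ {A : Set} n (x : A) → last (replicate (suc n) x) ≡ x
  last-replicate zero x = refl
  last-replicate (suc n) x = last-replicate n x

  Predecessor : ∀ {n} → Vec ℕ (suc n) → Composition → Set
  Predecessor e Q = (head e ≡ 1 × Q ≡ toList (tail e)) ⊎ (last e ≡ 1 × Q ≡ toList (init e))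
                    ⊎ (∃ λ i → unitVec i ≤ᵛ e × Q ≡ toList (e ∸ᵛ unitVec i))

  covers-toList⁻ : ∀ {n} (e : Vec ℕ (suc n)) {Q} → Covers (toList e) Q → Predecessor e Q
  covers-toList⁻ (x ∷ e) (inj₁ eq) = inj₁ (List.∷-injectiveˡ eq , sym (List.∷-injectiveʳ eq))
  covers-toList⁻ e (inj₂ (inj₁ eq))
    with Q≡ , 1≡ ← List.∷ʳ-injective _ _ (trans (sym eq) (toList-init-last e)) = inj₂ (inj₁ (sym 1≡ , Q≡))
  covers-toList⁻ e (inj₂ (inj₂ inc)) = inj₂ (inj₂ (inc-toList⁻ e inc))

  covers-toList⁺ : ∀ {n} (e : Vec ℕ (suc n)) {Q} → Predecessor e Q → Covers (toList e) Q
  covers-toList⁺ (x ∷ e) (inj₁ (refl , refl)) = inj₁ refl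
  covers-toList⁺ e (inj₂ (inj₁ (1≡ , refl))) =
    inj₂ (inj₁ (trans (toList-init-last e) (cong (toList (init e) List.∷ʳ_) 1≡)))
  covers-toList⁺ e (inj₂ (inj₂ (i , le , refl))) = inj₂ (inj₂ (inc-toList⁺ e i le))

module VariableCoefficients where

  open SeriesCoefficients
  open ExponentVectors
  open import Data.Nat as ℕ using (ℕ; zero; suc; _∸_; _≤ᵇ_)
  import Data.Nat.Properties as ℕ
  open import Data.Integer using (ℤ)
  open import Data.Fin as Fin using (fromℕ)
  open import Data.Vec as Vec using (Vec; []; _∷_; replicate; head; tail; init; last)
  import Data.Vec.Properties as Vec
  open import Data.Bool using (_∧_)
  open import Data.Bool.Properties using (∧-identityʳ)
  open import Relation.Nullary using (does)
  open import Relation.Nullary.Decidable using (⌊_⌋; dec-true)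
  open import Relation.Binary.PropositionalEquality using (_≡_; refl; trans; cong; cong₂; module ≡-Reasoning)

  private variable
    k : ℕ

  does-unitVec-zero-≤ᵛ : ∀ x (e : Vec ℕ k) → does (unitVec Fin.zero ≤ᵛ? (x ∷ e)) ≡ (1 ≤ᵇ x)
  does-unitVec-zero-≤ᵛ {k} x e = trans (cong (λ u → does (u ≤ᵛ? (x ∷ e))) unitVec-zero)
    (trans (cong ((1 ≤ᵇ x) ∧_) (dec-true (replicate k 0 ≤ᵛ? e) (replicate-0-≤ᵛ e))) (∧-identityʳ _))

  does-unitVec-fromℕ-≤ᵛ : ∀ k (e : Vec ℕ (suc k)) → does (unitVec (fromℕ k) ≤ᵛ? e) ≡ (1 ≤ᵇ last e)
  does-unitVec-fromℕ-≤ᵛ zero (x ∷ []) = ∧-identityʳ _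
  does-unitVec-fromℕ-≤ᵛ (suc k) (x ∷ e) =
    trans (cong (λ u → does (u ≤ᵛ? (x ∷ e))) (unitVec-suc (fromℕ k))) (does-unitVec-fromℕ-≤ᵛ k e)

  ∸ᵛ-unitVec-fromℕ : ∀ k (e : Vec ℕ (suc k)) → e ∸ᵛ unitVec (fromℕ k) ≡ init e Vec.∷ʳ (last e ∸ 1)
  ∸ᵛ-unitVec-fromℕ zero (x ∷ []) = refl
  ∸ᵛ-unitVec-fromℕ (suc k) (x ∷ e) =
    trans (∸ᵛ-unitVec-suc x e (fromℕ k)) (cong (x ∷_) (∸ᵛ-unitVec-fromℕ k e))

  guard-pred≡0 : ∀ x (z : ℤ) → [ 1 ≤ᵇ x ]· [ ⌊ (x ∸ 1) ℕ.≟ 0 ⌋ ]· z ≡ [ does (x ℕ.≟ 1) ]· z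
  guard-pred≡0 zero z = refl
  guard-pred≡0 (suc zero) z = refl
  guard-pred≡0 (suc (suc x)) z = refl

  coeff-var-*S-substTail : ∀ (F : FPS k) (e : Vec ℕ (suc k)) →
                           (var Fin.zero *S substTail F) e ≡ [ does (head e ℕ.≟ 1) ]· F (tail e)
  coeff-var-*S-substTail F (x ∷ e) = begin
    (var Fin.zero *S substTail F) (x ∷ e)
      ≡⟨ coeff-monomial-*S (substTail F) (unitVec Fin.zero) (x ∷ e) ⟩
    [ does (unitVec Fin.zero ≤ᵛ? (x ∷ e)) ]· substTail F ((x ∷ e) ∸ᵛ unitVec Fin.zero)
      ≡⟨ cong₂ (λ b v → [ b ]· substTail F v) (does-unitVec-zero-≤ᵛ x e) (∸ᵛ-unitVec-zero x e) ⟩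
    [ 1 ≤ᵇ x ]· substTail F ((x ∸ 1) ∷ e)
      ≡⟨ guard-pred≡0 x (F e) ⟩
    [ does (x ℕ.≟ 1) ]· F e ∎
    where open ≡-Reasoning

  coeff-var-*S-substInit : ∀ (F : FPS k) (e : Vec ℕ (suc k)) →
                           (var (fromℕ k) *S substInit F) e ≡ [ does (last e ℕ.≟ 1) ]· F (init e)
  coeff-var-*S-substInit {k} F e = begin
    (var (fromℕ k) *S substInit F) e
      ≡⟨ coeff-monomial-*S (substInit F) (unitVec (fromℕ k)) e ⟩
    [ does (unitVec (fromℕ k) ≤ᵛ? e) ]· substInit F (e ∸ᵛ unitVec (fromℕ k))
      ≡⟨ cong₂ (λ b v → [ b ]· substInit F v) (does-unitVec-fromℕ-≤ᵛ k e) (∸ᵛ-unitVec-fromℕ k e) ⟩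
    [ 1 ≤ᵇ last e ]· substInit F (init e Vec.∷ʳ (last e ∸ 1))
      ≡⟨ cong [ 1 ≤ᵇ last e ]·_ substInit-∷ʳ ⟩
    [ 1 ≤ᵇ last e ]· [ ⌊ (last e ∸ 1) ℕ.≟ 0 ⌋ ]· F (init e)
      ≡⟨ guard-pred≡0 (last e) (F (init e)) ⟩
    [ does (last e ℕ.≟ 1) ]· F (init e) ∎
    where
    open ≡-Reasoning
    substInit-∷ʳ : substInit F (init e Vec.∷ʳ (last e ∸ 1)) ≡ [ ⌊ (last e ∸ 1) ℕ.≟ 0 ⌋ ]· F (init e)
    substInit-∷ʳ = cong₂ (λ l v → [ ⌊ l ℕ.≟ 0 ⌋ ]· F v)
      (Vec.last-∷ʳ (last e ∸ 1) (init e)) (Vec.init-∷ʳ (last e ∸ 1) (init e))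

module StandardPaths where

  open Enumerations
  open SeriesCoefficients using (_≤ᵛ_; _∸ᵛ_; _≟ᵛ_)
  open ExponentVectors
  open import Data.Nat using (ℕ; zero; suc; _+_; _≤_; z≤n; s≤s)
  open import Data.Nat.Properties using (+-suc; +-comm; m≤m+n; ≤-trans)
  open import Data.Nat.ListAction using (sum)
  open import Data.Nat.ListAction.Properties using (sum-++)
  open import Data.Fin as Fin using (Fin)
  open import Data.Vec using (Vec; _∷_; head; tail; init; last)
  open import Data.List as List using (List; []; _∷_; [_]; _++_; _∷ʳ_; length; initLast; _∷ʳ′_)
  open import Data.List.Properties using (∷ʳ-injectiveˡ)
  open import Data.List.Relation.Unary.All using ([]; _∷_)
  open import Data.Maybe using (just)
  open import Data.Maybe.Properties using (just-injective)
  open import Data.Product using (∃; _×_; _,_; proj₁; proj₂; map₁; map₂)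
  open import Data.Sum using (inj₁; inj₂)
  open import Level using (0ℓ)
  open import Relation.Nullary using (yes; no)
  open import Relation.Unary using (Pred; _≐_; _∪_; ⋃; _⊆_)
  open import Relation.Binary.PropositionalEquality using (_≡_; _≢_; refl; sym; trans; cong; subst)

  private variable
    A : Set
    i k n p : ℕ
    P Q : Composition
    ps : Composition

  last-∷ʳ : ∀ (xs : List A) x → List.last (xs ∷ʳ x) ≡ just x
  last-∷ʳ [] x = refl
  last-∷ʳ (y ∷ []) x = refl
  last-∷ʳ (y ∷ z ∷ xs) x = last-∷ʳ (z ∷ xs) x

  last≡just⇒∷ʳ : ∀ (xs : List A) {x} → List.last xs ≡ just x → ∃ λ ys → xs ≡ ys ∷ʳ x
  last≡just⇒∷ʳ xs eq with initLast xs
  ... | ys ∷ʳ′ y = ys , cong (ys ∷ʳ_) (just-injective (trans (sym (last-∷ʳ ys y)) eq))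

  inc-weight : Inc Q P → weight Q ≡ suc (weight P)
  inc-weight here = refl
  inc-weight (there {p} inc) = trans (cong (p +_) (inc-weight inc)) (+-suc p _)

  covers-weight : Covers Q P → weight Q ≡ suc (weight P)
  covers-weight (inj₁ refl) = refl
  covers-weight {P = P} (inj₂ (inj₁ refl)) = trans (sum-++ P [ 1 ]) (+-comm (sum P) 1)
  covers-weight (inj₂ (inj₂ inc)) = inc-weight inc

  inc-isComposition : Inc Q P → IsComposition P → IsComposition Q
  inc-isComposition here (_ ∷ ps) = s≤s z≤n ∷ ps
  inc-isComposition (there inc) (p ∷ ps) = p ∷ inc-isComposition inc ps

  ∷ʳ-isComposition : IsComposition P → IsComposition (P ∷ʳ 1)
  ∷ʳ-isComposition [] = s≤s z≤n ∷ []
  ∷ʳ-isComposition (p ∷ ps) = p ∷ ∷ʳ-isComposition ps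

  covers-isComposition : Covers Q P → IsComposition P → IsComposition Q
  covers-isComposition (inj₁ refl) ps = s≤s z≤n ∷ ps
  covers-isComposition (inj₂ (inj₁ refl)) ps = ∷ʳ-isComposition ps
  covers-isComposition (inj₂ (inj₂ inc)) ps = inc-isComposition inc ps

  chain-last : ∀ γ → Chain i (γ ∷ʳ P) → IsComposition P × weight P ≡ length γ + i
  chain-last [] (single c w) = c , w
  chain-last (_ ∷ []) (cons _ _ _ ch) = chain-last [] ch
  chain-last {i} (_ ∷ R ∷ γ) (cons _ _ _ ch) =
    map₂ (λ w → trans w (+-suc (length (R ∷ γ)) i)) (chain-last (R ∷ γ) ch)

  chain-∷ʳ : ∀ γ → Chain i (γ ∷ʳ Q) → Covers P Q → Chain i (γ ∷ʳ Q ∷ʳ P)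
  chain-∷ʳ [] (single c w) cov =
    cons c w cov (single (covers-isComposition cov c) (trans (covers-weight cov) (cong suc w)))
  chain-∷ʳ (_ ∷ []) (cons c w cov′ ch) cov = cons c w cov′ (chain-∷ʳ [] ch cov)
  chain-∷ʳ (_ ∷ R ∷ γ) (cons c w cov′ ch) cov = cons c w cov′ (chain-∷ʳ (R ∷ γ) ch cov)

  chain-∷ʳ⁻ : ∀ γ → Chain i (γ ∷ʳ Q ∷ʳ P) → Chain i (γ ∷ʳ Q) × Covers P Q
  chain-∷ʳ⁻ [] (cons c w cov (single _ _)) = single c w , cov
  chain-∷ʳ⁻ (_ ∷ []) (cons c w cov′ ch) = map₁ (cons c w cov′) (chain-∷ʳ⁻ [] ch)
  chain-∷ʳ⁻ (_ ∷ R ∷ γ) (cons c w cov′ ch) = map₁ (cons c w cov′) (chain-∷ʳ⁻ (R ∷ γ) ch)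

  PathsTo : Composition → Pred (List Composition) 0ℓ
  PathsTo P γ = IsStandardPath γ × final γ ≡ just P

  PathsToVia : Composition → Composition → Pred (List Composition) 0ℓ
  PathsToVia P Q γ = ∃ λ δ → PathsTo Q δ × δ ∷ʳ P ≡ γ

  fromCountsPathsTo : CountsPathsTo n P → Enumeration (PathsTo P) n
  fromCountsPathsTo (enum , injective , sound , complete) = record
    { enum = enum ; injective = injective ; sound = sound ; complete = λ (γ , fin) → complete _ γ fin }

  pathsTo-isComposition : ∀ {γ} → PathsTo P γ → IsComposition P
  pathsTo-isComposition {γ = γ} (ch , fin) with last≡just⇒∷ʳ γ fin
  ... | δ , refl = proj₁ (chain-last δ ch)

  enumeration-pathsTo-[] : Enumeration (PathsTo []) 1
  enumeration-pathsTo-[] = record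
    { enum      = λ _ → [ [] ]
    ; injective = λ { {Fin.zero} {Fin.zero} _ → refl }
    ; sound     = λ _ → single [] refl , refl
    ; complete  = complete
    }
    where
    complete : ∀ {γ} → PathsTo [] γ → ∃ λ (_ : Fin 1) → [ [] ] ≡ γ
    complete {γ} (ch , fin) with last≡just⇒∷ʳ γ fin
    ... | δ , refl with δ | chain-last δ ch
    ...   | [] | _ = Fin.zero , refl
    ...   | _ ∷ _ | _ , ()

  pathsTo-≐-lastStep : PathsTo (p ∷ ps) ≐ λ γ → ∃ λ Q → Covers (p ∷ ps) Q × PathsToVia (p ∷ ps) Q γ
  pathsTo-≐-lastStep {p} {ps} = split , merge
    where
    split : ∀ {γ} → PathsTo (p ∷ ps) γ → ∃ λ Q → Covers (p ∷ ps) Q × PathsToVia (p ∷ ps) Q γ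
    split {γ} (ch , fin) with last≡just⇒∷ʳ γ fin
    ... | δ , refl with initLast δ
    ...   | [] with single (1≤p ∷ _) w ← ch
      with () ← subst (1 ≤_) w (≤-trans 1≤p (m≤m+n p (sum ps)))
    ...   | δ′ ∷ʳ′ Q with chain-∷ʳ⁻ δ′ ch
    ...     | ch′ , cov = Q , cov , δ′ ∷ʳ Q , (ch′ , last-∷ʳ δ′ Q) , refl

    merge : ∀ {γ} → (∃ λ Q → Covers (p ∷ ps) Q × PathsToVia (p ∷ ps) Q γ) → PathsTo (p ∷ ps) γ
    merge (Q , cov , δ , (ch , fin) , refl) with last≡just⇒∷ʳ δ fin
    ... | δ′ , refl = chain-∷ʳ δ′ ch cov , last-∷ʳ (δ′ ∷ʳ Q) (p ∷ ps)

  enumeration-pathsToVia : Enumeration (PathsTo Q) n → Enumeration (PathsToVia P Q) n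
  enumeration-pathsToVia {P = P} = enumeration-image (_∷ʳ P) (∷ʳ-injectiveˡ _ _)

  pathsToVia-unique : ∀ {Q′ γ} → PathsToVia P Q γ → PathsToVia P Q′ γ → Q ≡ Q′
  pathsToVia-unique (δ , (_ , fin) , refl) (δ′ , (_ , fin′) , eq)
    with refl ← ∷ʳ-injectiveˡ δ′ δ eq = just-injective (trans (sym fin) fin′)

  PathsViaTail : Vec ℕ (suc n) → Pred (List Composition) 0ℓ
  PathsViaTail e γ = head e ≡ 1 × PathsToVia (toList e) (toList (tail e)) γ

  -- init e ≢ tail e excludes e = (1, …, 1), whose back predecessor is its front one.
  PathsViaInit : Vec ℕ (suc n) → Pred (List Composition) 0ℓ
  PathsViaInit e γ = (last e ≡ 1 × init e ≢ tail e) × PathsToVia (toList e) (toList (init e)) γ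

  PathsViaDecrement : Vec ℕ k → Fin k → Pred (List Composition) 0ℓ
  PathsViaDecrement e i γ = unitVec i ≤ᵛ e × PathsToVia (toList e) (toList (e ∸ᵛ unitVec i)) γ

  pathsTo-≐-viaPredecessor : ∀ (e : Vec ℕ (suc n)) →
    PathsTo (toList e) ≐ PathsViaTail e ∪ (PathsViaInit e ∪ ⋃ (Fin (suc n)) (PathsViaDecrement e))
  pathsTo-≐-viaPredecessor e@(_ ∷ _) = split , merge
    where
    split : PathsTo (toList e) ⊆ PathsViaTail e ∪ (PathsViaInit e ∪ ⋃ _ (PathsViaDecrement e))
    split path with Q , cov , via ← proj₁ pathsTo-≐-lastStep path with covers-toList⁻ e cov
    ... | inj₁ (h , refl) = inj₁ (h , via)
    ... | inj₂ (inj₂ (i , le , refl)) = inj₂ (inj₂ (i , le , via))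
    ... | inj₂ (inj₁ (l , refl)) with init e ≟ᵛ tail e
    ...   | no i≢t = inj₂ (inj₁ ((l , i≢t) , via))
    ...   | yes i≡t = inj₁ (trans (cong head (init≡tail⇒≡replicate e i≡t)) l ,
                            subst (λ v → PathsToVia (toList e) (toList v) _) i≡t via)

    lastStep : ∀ {Q γ} → Predecessor e Q → PathsToVia (toList e) Q γ → PathsTo (toList e) γ
    lastStep pred via = proj₂ pathsTo-≐-lastStep (_ , covers-toList⁺ e pred , via)

    merge : PathsViaTail e ∪ (PathsViaInit e ∪ ⋃ _ (PathsViaDecrement e)) ⊆ PathsTo (toList e)
    merge (inj₁ (h , via)) = lastStep (inj₁ (h , refl)) via
    merge (inj₂ (inj₁ ((l , _) , via))) = lastStep (inj₂ (inj₁ (l , refl))) via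
    merge (inj₂ (inj₂ (i , le , via))) = lastStep (inj₂ (inj₂ (i , le , refl))) via

open Enumerations using (Enumeration)
open StandardPaths using (PathsTo; fromCountsPathsTo)

module PathCounts (c : (k : ℕ) → Vec ℕ k → ℕ)
                  (counts : ∀ k (e : Vec ℕ k) → Enumeration (PathsTo (toList e)) (c k e)) where

  open Enumerations
  open StandardPaths
  open SeriesCoefficients using (_≤ᵛ?_; _∸ᵛ_; _≟ᵛ_)
  open ExponentVectors
  open import Data.Nat as ℕ using (ℕ; zero; suc; _+_)
  open import Data.Nat.ListAction using (sum)
  open import Data.Fin as Fin using (Fin)
  open import Data.Vec using (Vec; []; toList; replicate; head; tail; init; last)
  open import Data.List as List using ()
  open import Data.Product using (_×_; _,_)
  open import Data.Sum using (inj₁; inj₂)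
  open import Data.Bool using (true; false; if_then_else_)
  open import Relation.Nullary using (Dec; ¬_; ¬?; does; _×-dec_)
  open import Relation.Nullary.Decidable using (dec-false)
  open import Relation.Unary using (_⊥_; ⋃; _∪_)
  open import Relation.Binary.PropositionalEquality using (_≡_; refl; sym; cong; cong₂; module ≡-Reasoning)
  open import Function using (id; _∘_)

  private variable
    k n : ℕ

  countViaTail : Vec ℕ (suc n) → ℕ
  countViaTail {n} e = if does (head e ℕ.≟ 1) then c n (tail e) else 0

  countViaInit : Vec ℕ (suc n) → ℕ
  countViaInit {n} e = if does (last e ℕ.≟ 1 ×-dec ¬? (init e ≟ᵛ tail e)) then c n (init e) else 0

  countViaDecrement : Vec ℕ k → Fin k → ℕ
  countViaDecrement {k} e i = if does (unitVec i ≤ᵛ? e) then c k (e ∸ᵛ unitVec i) else 0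

  c-recurrence : ∀ (e : Vec ℕ (suc n)) →
                 c (suc n) e ≡ countViaTail e + (countViaInit e + sum (List.tabulate (countViaDecrement e)))
  c-recurrence {n} e = size-unique (counts _ e)
    (enumeration-∪ tail⊥rest (via (head e ℕ.≟ 1) (tail e))
      (enumeration-∪ init⊥decrement (via (last e ℕ.≟ 1 ×-dec ¬? (init e ≟ᵛ tail e)) (init e))
        (enumeration-⋃ decrement-pairwise (λ i → via (unitVec i ≤ᵛ? e) (e ∸ᵛ unitVec i)))))
    (pathsTo-≐-viaPredecessor e)
    where
    via : ∀ {k} {G : Set} (G? : Dec G) (q : Vec ℕ k) →
          Enumeration (λ γ → G × PathsToVia (toList e) (toList q) γ) (if does G? then c k q else 0)
    via G? q = enumeration-guard G? (enumeration-pathsToVia (counts _ q))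

    tail⊥rest : PathsViaTail e ⊥ (PathsViaInit e ∪ ⋃ _ (PathsViaDecrement e))
    tail⊥rest ((_ , t) , inj₁ ((_ , i≢t) , i)) = i≢t (sym (toList-cancel _ _ (pathsToVia-unique t i)))
    tail⊥rest ((_ , t) , inj₂ (_ , _ , d)) = toList-≢-suc _ _ (pathsToVia-unique t d)

    init⊥decrement : PathsViaInit e ⊥ ⋃ _ (PathsViaDecrement e)
    init⊥decrement ((_ , i) , (_ , _ , d)) = toList-≢-suc _ _ (pathsToVia-unique i d)

    decrement-pairwise : ∀ {i j γ} → PathsViaDecrement e i γ → PathsViaDecrement e j γ → i ≡ j
    decrement-pairwise (le , v) (_ , w) =
      ∸ᵛ-unitVec-injective e le (toList-cancel _ _ (pathsToVia-unique v w))

  c-[] : c 0 [] ≡ 1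
  c-[] = size-unique (counts 0 []) enumeration-pathsTo-[] (id , id)

  c-nonComposition : ∀ (e : Vec ℕ k) → ¬ IsComposition (toList e) → c k e ≡ 0
  c-nonComposition e ¬comp =
    size-unique (counts _ e) enumeration-∅ ((λ path → ¬comp (pathsTo-isComposition path)) , λ ())

  countViaInit-replicate : ∀ n → countViaInit (replicate (suc n) 1) ≡ 0
  countViaInit-replicate n = cong (λ b → if b then c n (init ones) else 0)
    (dec-false (last ones ℕ.≟ 1 ×-dec ¬? (init ones ≟ᵛ tail ones)) λ (_ , i≢t) → i≢t (init-replicate n 1))
    where
    ones : Vec ℕ (suc n)
    ones = replicate (suc n) 1

  c-replicate-1 : ∀ n → c n (replicate n 1) ≡ 1
  c-replicate-1 zero = c-[]
  c-replicate-1 (suc n) = begin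
    c (suc n) ones
      ≡⟨ c-recurrence ones ⟩
    c n (replicate n 1) + (countViaInit ones + sum (List.tabulate (countViaDecrement ones)))
      ≡⟨ cong₂ _+_ (c-replicate-1 n) (cong₂ _+_ (countViaInit-replicate n) (sum-tabulate-0 noDecrement)) ⟩
    1 ∎
    where
    open ≡-Reasoning
    ones : Vec ℕ (suc n)
    ones = replicate (suc n) 1
    guarded-0 : ∀ b {x} → x ≡ 0 → (if b then x else 0) ≡ 0
    guarded-0 true x≡0 = x≡0
    guarded-0 false _ = refl
    noDecrement : ∀ i → countViaDecrement ones i ≡ 0
    noDecrement i = guarded-0 (does (unitVec i ≤ᵛ? ones)) (c-nonComposition _ (replicate-1-∸ᵛ-unitVec i))
    sum-tabulate-0 : ∀ {k} {f : Fin k → ℕ} → (∀ i → f i ≡ 0) → sum (List.tabulate f) ≡ 0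
    sum-tabulate-0 {zero} _ = refl
    sum-tabulate-0 {suc k} f≡0 = cong₂ _+_ (f≡0 Fin.zero) (sum-tabulate-0 (f≡0 ∘ Fin.suc))

module GeneratingSeries (c : (k : ℕ) → Vec ℕ k → ℕ)
                        (counts : ∀ k (e : Vec ℕ k) → Enumeration (PathsTo (toList e)) (c k e)) where

  open PathCounts c counts
  open SeriesCoefficients
  open ExponentVectors
  open VariableCoefficients
  open import Data.Nat as ℕ using (ℕ; zero; suc)
  import Data.Nat.Properties as ℕ
  open import Data.Nat.ListAction using (sum)
  open import Data.Integer using (ℤ; +_; _+_; _-_)
  import Data.Integer.Properties as ℤ
  open import Data.Integer.Solver using (module +-*-Solver)
  open import Data.Fin as Fin using (fromℕ)
  open import Data.Vec using (Vec; []; _∷_; replicate; tail; init; last)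
  open import Data.List as List using ()
  open import Data.Bool using (if_then_else_)
  open import Data.Bool.Properties using (∧-identityʳ; ∧-zeroʳ)
  open import Relation.Nullary using (does; yes; no; ¬?; _×-dec_)
  open import Relation.Nullary.Decidable using (dec-true; dec-false)
  open import Relation.Binary.PropositionalEquality
    using (_≡_; _≢_; refl; sym; trans; cong; cong₂; module ≡-Reasoning)

  private variable
    k : ℕ

  coeff-genSeries-*S-oneS : ∀ (e : Vec ℕ k) → (genSeries c k *S oneS) e ≡ + c k e
  coeff-genSeries-*S-oneS {k} e = begin
    (genSeries c k *S oneS) e
      ≡⟨ coeff-*S-monomial (genSeries c k) (replicate k 0) e ⟩
    [ does (replicate k 0 ≤ᵛ? e) ]· + c k (e ∸ᵛ replicate k 0)
      ≡⟨ cong₂ (λ b v → [ b ]· + c k v) (dec-true (replicate k 0 ≤ᵛ? e) (replicate-0-≤ᵛ e)) (∸ᵛ-replicate-0 e) ⟩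
    + c k e ∎
    where open ≡-Reasoning

  coeff-genSeries-*S-var : ∀ (e : Vec ℕ k) i → (genSeries c k *S var i) e ≡ + countViaDecrement e i
  coeff-genSeries-*S-var {k} e i = trans (coeff-*S-monomial (genSeries c k) (unitVec i) e) (sym (+-if _ _))

  coeff-genSeries-*S-1-var : ∀ (e : Vec ℕ k) i →
                             (genSeries c k *S (oneS -S var i)) e ≡ + c k e - + countViaDecrement e i
  coeff-genSeries-*S-1-var {k} e i = trans (*S-distribˡ--S (genSeries c k) oneS (var i) e)
    (cong₂ _-_ (coeff-genSeries-*S-oneS e) (coeff-genSeries-*S-var e i))

  coeff-genSeries-*S-1-sumVars : ∀ (e : Vec ℕ k) →
    (genSeries c k *S (oneS -S sumVars)) e ≡ + c k e - + sum (List.tabulate (countViaDecrement e))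
  coeff-genSeries-*S-1-sumVars {k} e = trans (*S-distribˡ--S (genSeries c k) oneS sumVars e)
    (cong₂ _-_ (coeff-genSeries-*S-oneS e)
      (trans (coeff-*S-sumVars (genSeries c k) e) (sumℤ-tabulate-+ _ _ (coeff-genSeries-*S-var e))))

  countViaInit-≢replicate : ∀ {n} (e : Vec ℕ (suc n)) → e ≢ replicate (suc n) 1 →
    (if does (last e ℕ.≟ 1 ×-dec ¬? (init e ≟ᵛ tail e)) then c n (init e) else 0)
    ≡ (if does (last e ℕ.≟ 1) then c n (init e) else 0)
  countViaInit-≢replicate {n} e e≢1 with init e ≟ᵛ tail e
  ... | no _ = cong (λ b → if b then c n (init e) else 0) (∧-identityʳ _)
  ... | yes i≡t = cong (λ b → if b then c n (init e) else 0) (trans (∧-zeroʳ _) (sym last≢1))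
    where
    last≢1 : does (last e ℕ.≟ 1) ≡ _
    last≢1 = dec-false (last e ℕ.≟ 1) λ l≡1 → e≢1 (trans (init≡tail⇒≡replicate e i≡t) (cong (replicate _) l≡1))

  -- At e = (1, …, 1), the only vector where countViaInit drops a term, that term is c (1, …, 1) = 1.
  countViaInit-+-prodVars : ∀ {n} (e : Vec ℕ (suc n)) →
                            + countViaInit e + prodVars e ≡ [ does (last e ℕ.≟ 1) ]· + c n (init e)
  countViaInit-+-prodVars {n} e with e ≟ᵛ replicate (suc n) 1
  ... | no e≢1 = trans (ℤ.+-identityʳ _) (trans (cong +_ (countViaInit-≢replicate e e≢1)) (+-if _ _))
  ... | yes refl = begin
    + countViaInit ones + + 1             ≡⟨ cong (λ x → + x + + 1) (countViaInit-replicate n) ⟩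
    + 1                                   ≡⟨ cong +_ (c-replicate-1 n) ⟨
    + c n (replicate n 1)                 ≡⟨ cong (λ v → + c n v) (init-replicate n 1) ⟨
    + c n (init ones)
      ≡⟨ cong (λ b → [ b ]· + c n (init ones)) (dec-true (last ones ℕ.≟ 1) (last-replicate n 1)) ⟨
    [ does (last ones ℕ.≟ 1) ]· + c n (init ones) ∎
    where
    open ≡-Reasoning
    ones : Vec ℕ (suc n)
    ones = replicate (suc n) 1

  genSeries-0 : genSeries c 0 ≈ oneS
  genSeries-0 [] = cong +_ c-[]

  genSeries-1 : genSeries c 1 *S (oneS -S var Fin.zero) ≈ var Fin.zero
  genSeries-1 (x ∷ []) = begin
    (genSeries c 1 *S (oneS -S var Fin.zero)) (x ∷ [])  ≡⟨ coeff-genSeries-*S-1-var (x ∷ []) Fin.zero ⟩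
    + c 1 (x ∷ []) - + d                                ≡⟨ cong (λ y → + y - + d) c-x ⟩
    + (countViaTail (x ∷ []) ℕ.+ d) - + d               ≡⟨ +-minus (countViaTail (x ∷ [])) d ⟩
    + countViaTail (x ∷ [])                             ≡⟨ countViaTail≡var x ⟩
    var Fin.zero (x ∷ []) ∎
    where
    open ≡-Reasoning
    d : ℕ
    d = countViaDecrement (x ∷ []) Fin.zero
    noInit : countViaInit (x ∷ []) ≡ 0
    noInit = cong (λ b → if b then c 0 [] else 0) (dec-false (x ℕ.≟ 1 ×-dec ¬? ([] ≟ᵛ [])) λ (_ , ne) → ne refl)
    c-x : c 1 (x ∷ []) ≡ countViaTail (x ∷ []) ℕ.+ d
    c-x = trans (c-recurrence (x ∷ []))
      (cong (countViaTail (x ∷ []) ℕ.+_) (trans (cong (ℕ._+ (d ℕ.+ 0)) noInit) (ℕ.+-identityʳ d)))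
    +-minus : ∀ t d → + (t ℕ.+ d) - + d ≡ + t
    +-minus t d = trans (cong (_- + d) (ℤ.pos-+ t d)) (solve 2 (λ t d → t :+ d :- d := t) refl (+ t) (+ d))
      where open +-*-Solver
    countViaTail≡var : ∀ x → + countViaTail (x ∷ []) ≡ var Fin.zero (x ∷ [])
    countViaTail≡var zero = refl
    countViaTail≡var (suc zero) = cong +_ c-[]
    countViaTail≡var (suc (suc x)) = refl

  genSeries-recurrence : ∀ m → genSeries c (suc (suc m)) *S (oneS -S sumVars)
                               ≈ var Fin.zero *S substTail (genSeries c (suc m))
                                 +S var (fromℕ (suc m)) *S substInit (genSeries c (suc m))
                                 -S prodVars
  genSeries-recurrence m e = begin
    (G *S (oneS -S sumVars)) e
      ≡⟨ coeff-genSeries-*S-1-sumVars e ⟩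
    + c (suc (suc m)) e - + d
      ≡⟨ cong (λ y → + y - + d) (c-recurrence e) ⟩
    + (countViaTail e ℕ.+ (countViaInit e ℕ.+ d)) - + d
      ≡⟨ rearrange (countViaTail e) (countViaInit e) d (prodVars e) ⟩
    + countViaTail e + (+ countViaInit e + prodVars e) - prodVars e
      ≡⟨ cong₂ (λ t i → t + i - prodVars e) tail-coeff (countViaInit-+-prodVars e) ⟩
    (var Fin.zero *S substTail G′) e + [ does (last e ℕ.≟ 1) ]· + c (suc m) (init e) - prodVars e
      ≡⟨ cong (λ i → (var Fin.zero *S substTail G′) e + i - prodVars e) (coeff-var-*S-substInit G′ e) ⟨
    (var Fin.zero *S substTail G′ +S var (fromℕ (suc m)) *S substInit G′ -S prodVars) e ∎
    where
    open ≡-Reasoning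
    G : FPS (suc (suc m))
    G = genSeries c (suc (suc m))
    G′ : FPS (suc m)
    G′ = genSeries c (suc m)
    d : ℕ
    d = sum (List.tabulate (countViaDecrement e))
    tail-coeff : + countViaTail e ≡ (var Fin.zero *S substTail G′) e
    tail-coeff = trans (+-if _ _) (sym (coeff-var-*S-substTail G′ e))
    rearrange : ∀ t i d p → + (t ℕ.+ (i ℕ.+ d)) - + d ≡ + t + (+ i + p) - p
    rearrange t i d p = trans (cong (_- + d) (trans (ℤ.pos-+ t _) (cong (_+_ (+ t)) (ℤ.pos-+ i d))))
      (solve 4 (λ t i d p → t :+ (i :+ d) :- d := t :+ (i :+ p) :- p) refl (+ t) (+ i) (+ d) p)
      where open +-*-Solver

mainTheorem1 : (c : (k : ℕ) → Vec ℕ k → ℕ) →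
    (∀ k (e : Vec ℕ k) → CountsPathsTo (c k e) (toList e)) →
    (genSeries c 0 ≈ oneS)
    × (genSeries c 1 *S (oneS -S var zero) ≈ var zero)
    × (∀ m → genSeries c (suc (suc m)) *S (oneS -S sumVars)
             ≈ var zero *S substTail (genSeries c (suc m))
               +S var (fromℕ (suc m)) *S substInit (genSeries c (suc m))
               -S prodVars)
mainTheorem1 c counts = genSeries-0 , genSeries-1 , genSeries-recurrence
  where open GeneratingSeries c (λ k e → fromCountsPathsTo (counts k e))
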